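{- The class $\mathcal T$ of all finite two-graphs has EPPA: for every finite two-graph $\mathbf A$ there exists a finite two-graph $\mathbf B$ containing $\mathbf A$ as an induced substructure such that every isomorphism between induced substructures of $\mathbf A$ extends to an automorphism of $\mathbf B$.
   Context: A two-graph is a 3-uniform hypergraph such that every set of four vertices contains an even number of hyperedges. Substructures are induced: a substructure of a two-graph $\mathbf B$ on a vertex set $S\subseteq B$ has as hyperedges exactly the hyperedges of $\mathbf B$ contained in $S$. A class $\mathcal C$ of finite structures has the extension property for partial automorphisms (EPPA) if for every $\mathbf A\in\mathcal C$ there is $\mathbf B\in\mathcal C$ containing $\mathbf A$ as an induced substructure such that every isomorphism between induced substructures of $\mathbf A$ (a partial automorphism of $\mathbf A$) extends to an automorphism of $\mathbf B$. -}

module Defs where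

open import Data.Nat using (ℕ; _+_)
open import Data.Nat.Properties using ()
open import Data.Bool using (Bool; true; false; T)
open import Data.Fin using (Fin)
open import Data.Product using (Σ; _×_; _,_; ∃)
open import Relation.Binary.PropositionalEquality using (_≡_; _≢_)
open import Data.Nat.Divisibility using (_∣_)
open import Function.Bundles using (_↔_; Inverse)

b2n : Bool → ℕ
b2n true  = 1
b2n false = 0

-- The hyperedge relation is a Bool-valued predicate on ordered triples,
-- required to be invariant under permutations and to hold only on triples
-- of pairwise distinct vertices; hyperedges are then the 3-element sets
-- {x,y,z} with edge x y z ≡ true.
record Hypergraph3 (n : ℕ) : Set where
  field
    edge      : Fin n → Fin n → Fin n → Bool
    sym₁₂     : ∀ x y z → edge x y z ≡ edge y x z
    sym₂₃     : ∀ x y z → edge x y z ≡ edge x z y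
    distinct₁₂ : ∀ x z → edge x x z ≡ false
    distinct₂₃ : ∀ x y → edge x y y ≡ false
open Hypergraph3 public

IsTwoGraph : ∀ {n} → Hypergraph3 n → Set
IsTwoGraph {n} H =
  ∀ (a b c d : Fin n) → a ≢ b → a ≢ c → a ≢ d → b ≢ c → b ≢ d → c ≢ d →
  2 ∣ (b2n (edge H a b c) + b2n (edge H a b d) + b2n (edge H a c d) + b2n (edge H b c d))

record TwoGraph (n : ℕ) : Set where
  field
    hyp     : Hypergraph3 n
    twoGraph : IsTwoGraph hyp
open TwoGraph public

record Embedding {n m : ℕ} (A : Hypergraph3 n) (B : Hypergraph3 m) : Set where
  field
    fun       : Fin n → Fin m
    injective : ∀ x y → fun x ≡ fun y → x ≡ y
    preserves : ∀ x y z → edge B (fun x) (fun y) (fun z) ≡ edge A x y z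
open Embedding public

-- It is given by its domain (a subset of the vertices, as a Bool
-- predicate) and a map φ that is injective on the domain and such that
-- x,y,z in the domain form a hyperedge iff φx,φy,φz do. (The codomain
-- substructure is the image of the domain.)
record PartialAut {n : ℕ} (A : Hypergraph3 n) : Set where
  field
    dom       : Fin n → Bool
    φ         : Fin n → Fin n
    injective : ∀ x y → T (dom x) → T (dom y) → φ x ≡ φ y → x ≡ y
    preserves : ∀ x y z → T (dom x) → T (dom y) → T (dom z) →
                edge A (φ x) (φ y) (φ z) ≡ edge A x y z
open PartialAut public

record Automorphism {m : ℕ} (B : Hypergraph3 m) : Set where
  field
    perm      : Fin m ↔ Fin m
    preserves : ∀ x y z →
      edge B (Inverse.to perm x) (Inverse.to perm y) (Inverse.to perm z) ≡ edge B x y z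
open Automorphism public

Extends : ∀ {n m} {A : Hypergraph3 n} {B : Hypergraph3 m} →
          Embedding A B → PartialAut A → Automorphism B → Set
Extends e p g =
  ∀ x → T (dom p x) → Inverse.to (perm g) (fun e x) ≡ fun e (φ p x)

TwoGraphsHaveEPPA : Set
TwoGraphsHaveEPPA =
  ∀ (n : ℕ) (A : TwoGraph n) →
  Σ ℕ λ m → Σ (TwoGraph m) λ B → Σ (Embedding (hyp A) (hyp B)) λ e →
    ∀ (p : PartialAut (hyp A)) → Σ (Automorphism (hyp B)) λ g → Extends e p g

module Submission where

-- Every two-graph on a vertex set is the set of triples spanning an odd
-- number of edges of some graph (its link at any vertex), and a graph
-- determines its two-graph only up to switching: flipping all edges between
-- a set of vertices and its complement.  So it suffices to prove EPPA for
-- graphs with respect to switchings: every partial switching-isomorphism of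
-- G extends to a switching-automorphism of a finite graph Ĝ containing G.
--
-- Ĝ is the valuation graph over L = two disjoint copies of V(G): vertices
-- are pairs (ℓ , f) with ℓ ∈ L and f : L → Bool, and (ℓ , f), (ℓ' , f') with
-- ℓ ≠ ℓ' are adjacent iff f ℓ' xor f' ℓ.  A permutation σ of L together with
-- a correction term g moves (ℓ , f) to (σ ℓ , f ∘ σ⁻¹ xor g ℓ ∘ σ⁻¹); this
-- is a switching-automorphism when g is "antisymmetric up to a switch".
-- A partial injection of V(G) extends to a permutation of L, and G embeds
-- into Ĝ via an orientation of its edges; the correction term is chosen so
-- that the move fixes this copy of G as prescribed.

open import Defs
open import Data.Nat using (ℕ; zero; suc; _+_; _*_; _^_)
open import Data.Nat.Divisibility using (_∣_; divides; ∣m∣n⇒∣m+n; ∣-refl)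
open import Data.Bool using (Bool; true; false; T; not; _xor_; _∧_; if_then_else_)
open import Data.Bool.Properties using (not-involutive; not-distribˡ-xor; xor-identityʳ; xor-same; xor-comm; T?; T-≡)
open import Data.Bool.Solver using (module xor-∧-Solver)
open import Data.Fin using (Fin; zero)
open import Data.Fin.Properties using (_≟_; _<?_; <-cmp; any?; +↔⊎; *↔×; 2↔Bool)
open import Data.Product using (Σ; _×_; _,_; ∃; proj₁; proj₂)
open import Data.Product.Function.NonDependent.Propositional using (_×-↔_)
open import Data.Sum using (_⊎_; inj₁; inj₂)
open import Data.Sum.Properties using (inj₁-injective; ≡-dec)
open import Data.Vec using (Vec; []; _∷_; lookup; tabulate)
open import Data.Vec.Properties using (lookup∘tabulate; tabulate∘lookup; tabulate-cong)
open import Function.Bundles using (_↔_; Inverse; mk↔ₛ′; Equivalence)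
open import Function.Properties.Inverse using (↔-trans; ↔-sym)
open import Relation.Binary.Definitions using (DecidableEquality; tri<; tri≈; tri>)
open import Relation.Binary.PropositionalEquality
open import Relation.Nullary using (Dec; yes; no; ¬_; does; contradiction)
open import Relation.Nullary.Decidable using (_×-dec_; _⊎-dec_; dec-true; dec-false)
open import Data.Empty using (⊥-elim)
open import Function using (case_of_)

open Inverse using (to; from; strictlyInverseˡ; strictlyInverseʳ)
open xor-∧-Solver using (solve; _:+_; _:=_; con)
open ≡-Reasoning

T⇒≡true : ∀ {b} → T b → b ≡ true
T⇒≡true = Equivalence.to T-≡

≡true⇒T : ∀ {b} → b ≡ true → T b
≡true⇒T = Equivalence.from T-≡
cancel : ∀ a b → (a xor b) xor b ≡ a
cancel = solve 2 (λ a b → (a :+ b) :+ b := a) refl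

-- Parity of a natural number, and the parity of a count of truth values:
-- it turns the evenness condition of two-graphs into an xor equation.
parity : ℕ → Bool
parity zero    = false
parity (suc m) = not (parity m)

parity-+b2n : ∀ m p → parity (m + b2n p) ≡ parity m xor p
parity-+b2n zero    false = refl
parity-+b2n zero    true  = refl
parity-+b2n (suc m) p     =
  trans (cong not (parity-+b2n m p)) (not-distribˡ-xor (parity m) p)

even⇒parity-false : ∀ {m} → 2 ∣ m → parity m ≡ false
even⇒parity-false (divides q refl) = parity-double q
  where
  parity-double : ∀ q → parity (q * 2) ≡ false
  parity-double zero    = refl
  parity-double (suc q) = trans (not-involutive (parity (q * 2))) (parity-double q)

parity-false⇒even : ∀ m → parity m ≡ false → 2 ∣ m
parity-false⇒even zero          _  = divides 0 refl
parity-false⇒even (suc zero)    ()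
parity-false⇒even (suc (suc m)) eq =
  ∣m∣n⇒∣m+n (∣-refl {2}) (parity-false⇒even m (trans (sym (not-involutive (parity m))) eq))

parity-count4 : ∀ a b c d →
  parity (b2n a + b2n b + b2n c + b2n d) ≡ a xor b xor c xor d
parity-count4 a b c d = begin
  parity (b2n a + b2n b + b2n c + b2n d)  ≡⟨ parity-+b2n (b2n a + b2n b + b2n c) d ⟩
  parity (b2n a + b2n b + b2n c) xor d    ≡⟨ cong (_xor d) (parity-+b2n (b2n a + b2n b) c) ⟩
  (parity (b2n a + b2n b) xor c) xor d    ≡⟨ cong (λ t → (t xor c) xor d) (parity-+b2n (b2n a) b) ⟩
  ((parity (b2n a) xor b) xor c) xor d    ≡⟨ cong (λ t → ((t xor b) xor c) xor d) (parity-+b2n 0 a) ⟩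
  ((a xor b) xor c) xor d                 ≡⟨ solve 4 (λ a b c d → ((a :+ b) :+ c) :+ d := a :+ (b :+ (c :+ d))) refl a b c d ⟩
  a xor b xor c xor d                     ∎

even-count⇒xor : ∀ a b c d →
  2 ∣ b2n a + b2n b + b2n c + b2n d → a xor b xor c xor d ≡ false
even-count⇒xor a b c d even = trans (sym (parity-count4 a b c d)) (even⇒parity-false even)

xor⇒even-count : ∀ a b c d →
  a xor b xor c xor d ≡ false → 2 ∣ b2n a + b2n b + b2n c + b2n d
xor⇒even-count a b c d eq = parity-false⇒even _ (trans (parity-count4 a b c d) eq)

record Graph (V : Set) : Set where
  field
    adj        : V → V → Bool
    adj-sym    : ∀ u v → adj u v ≡ adj v u
    adj-irrefl : ∀ v → adj v v ≡ false
open Graph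

triangle : ∀ {V} → Graph V → V → V → V → Bool
triangle G x y z = adj G x y xor adj G y z xor adj G x z

-- The two-graph of G: its hyperedges are the odd triangles.  The four
-- triangles of any four vertices cover each of the six pairs twice.
twoGraphOf : ∀ {m} → Graph (Fin m) → TwoGraph m
twoGraphOf G = record { hyp = oddTriangles ; twoGraph = evenQuadruples }
  where
  oddTriangles : Hypergraph3 _
  oddTriangles = record
    { edge       = triangle G
    ; sym₁₂      = λ x y z → begin
        adj G x y xor adj G y z xor adj G x z  ≡⟨ cong (λ t → t xor adj G y z xor adj G x z) (adj-sym G x y) ⟩
        adj G y x xor adj G y z xor adj G x z  ≡⟨ solve 3 (λ a b c → a :+ (b :+ c) := a :+ (c :+ b)) refl (adj G y x) (adj G y z) (adj G x z) ⟩
        adj G y x xor adj G x z xor adj G y z  ∎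
    ; sym₂₃      = λ x y z → begin
        adj G x y xor adj G y z xor adj G x z  ≡⟨ cong (λ t → adj G x y xor t xor adj G x z) (adj-sym G y z) ⟩
        adj G x y xor adj G z y xor adj G x z  ≡⟨ solve 3 (λ a b c → a :+ (b :+ c) := c :+ (b :+ a)) refl (adj G x y) (adj G z y) (adj G x z) ⟩
        adj G x z xor adj G z y xor adj G x y  ∎
    ; distinct₁₂ = λ x z → begin
        adj G x x xor adj G x z xor adj G x z  ≡⟨ cong (λ t → t xor adj G x z xor adj G x z) (adj-irrefl G x) ⟩
        adj G x z xor adj G x z                ≡⟨ xor-same (adj G x z) ⟩
        false                                  ∎
    ; distinct₂₃ = λ x y → begin
        adj G x y xor adj G y y xor adj G x y  ≡⟨ cong (λ t → adj G x y xor t xor adj G x y) (adj-irrefl G y) ⟩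
        adj G x y xor adj G x y                ≡⟨ xor-same (adj G x y) ⟩
        false                                  ∎
    }

  evenQuadruples : IsTwoGraph oddTriangles
  evenQuadruples a b c d _ _ _ _ _ _ =
    xor⇒even-count (triangle G a b c) (triangle G a b d) (triangle G a c d) (triangle G b c d)
      (solve 6 (λ ab ac ad bc bd cd →
                  (ab :+ (bc :+ ac)) :+ ((ab :+ (bd :+ ad)) :+ ((ac :+ (cd :+ ad)) :+ (bc :+ (cd :+ bd))))
                  := con false) refl
               (adj G a b) (adj G a c) (adj G a d) (adj G b c) (adj G b d) (adj G c d))

Represents : ∀ {n} → Hypergraph3 n → Graph (Fin n) → Set
Represents H G = ∀ x y z → edge H x y z ≡ triangle G x y z

distinct₁₃ : ∀ {n} (H : Hypergraph3 n) x y → edge H x y x ≡ false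
distinct₁₃ H x y = trans (sym₂₃ H x y x) (distinct₁₂ H x y)

repeated-no-edge : ∀ {n} (H : Hypergraph3 n) {x y z : Fin n} →
                   x ≡ y ⊎ y ≡ z ⊎ x ≡ z → edge H x y z ≡ false
repeated-no-edge H {x} {z = z} (inj₁ refl)        = distinct₁₂ H x z
repeated-no-edge H {x} {y}     (inj₂ (inj₁ refl)) = distinct₂₃ H x y
repeated-no-edge H {x} {y}     (inj₂ (inj₂ refl)) = distinct₁₃ H x y

link : ∀ {n} → TwoGraph n → Fin n → Graph (Fin n)
link A a = record
  { adj = edge (hyp A) a ; adj-sym = sym₂₃ (hyp A) a ; adj-irrefl = distinct₂₃ (hyp A) a }

xor-solve-last : ∀ p q r s → p xor q xor r xor s ≡ false → s ≡ p xor r xor q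
xor-solve-last p q r s eq = begin
  s                                            ≡⟨ solve 4 (λ p q r s → s := (p :+ (q :+ (r :+ s))) :+ (p :+ (r :+ q))) refl p q r s ⟩
  (p xor q xor r xor s) xor (p xor r xor q)    ≡⟨ cong (_xor (p xor r xor q)) eq ⟩
  p xor r xor q                                ∎

-- If two of x, y, z coincide both
-- sides vanish; if a is one of them, two of the three terms on the right
-- vanish; for four distinct vertices it is the evenness condition.
link-represents : ∀ {n} (A : TwoGraph n) (a : Fin n) → Represents (hyp A) (link A a)
link-represents A a x y z
  with (x ≟ y) ⊎-dec (y ≟ z) ⊎-dec (x ≟ z)
... | yes rep = trans (repeated-no-edge (hyp A) rep) (sym (repeated-no-edge (hyp (twoGraphOf (link A a))) rep))
... | no distinct with a ≟ x | a ≟ y | a ≟ z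
...   | yes refl | _ | _
        rewrite distinct₁₂ (hyp A) a y | distinct₁₂ (hyp A) a z = sym (xor-identityʳ _)
...   | no _ | yes refl | _
        rewrite distinct₁₃ (hyp A) a x | distinct₁₂ (hyp A) a z = sym₁₂ (hyp A) x a z
...   | no _ | no _ | yes refl
        rewrite distinct₁₃ (hyp A) a y | distinct₁₃ (hyp A) a x
        = trans (trans (sym₂₃ (hyp A) x y a) (sym₁₂ (hyp A) x a y)) (sym (xor-identityʳ _))
...   | no a≢x | no a≢y | no a≢z =
        xor-solve-last (h a x y) (h a x z) (h a y z) (h x y z)
          (even-count⇒xor (h a x y) (h a x z) (h a y z) (h x y z) (twoGraph A a x y z a≢x a≢y a≢z x≢y x≢z y≢z))
  where
  h = edge (hyp A)
  x≢y = λ eq → distinct (inj₁ eq)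
  y≢z = λ eq → distinct (inj₂ (inj₁ eq))
  x≢z = λ eq → distinct (inj₂ (inj₂ eq))

represent : ∀ {n} (A : TwoGraph n) → Σ (Graph (Fin n)) (Represents (hyp A))
represent {zero}  A = record { adj = λ () ; adj-sym = λ () ; adj-irrefl = λ () } , λ ()
represent {suc n} A = link A zero , link-represents A zero

-- A switching-automorphism of G: a permutation of the vertices mapping G to
-- the graph obtained from G by switching at the vertices where `switch`
-- holds (flipping exactly the pairs separated by that set).
record Switching {V : Set} (G : Graph V) : Set where
  field
    permutation  : V ↔ V
    switch       : V → Bool
    adj-switched : ∀ u v → adj G (to permutation u) (to permutation v)
                           ≡ adj G u v xor switch u xor switch v
open Switching

-- Switching does not change the parity of a triangle, so a
-- switching-automorphism is an automorphism of the two-graph.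
switching⇒automorphism : ∀ {m} {G : Graph (Fin m)} → Switching G → Automorphism (hyp (twoGraphOf G))
switching⇒automorphism {G = G} F = record
  { perm      = permutation F
  ; preserves = λ x y z → begin
      triangle G (π x) (π y) (π z)
        ≡⟨ cong₂ _xor_ (adj-switched F x y) (cong₂ _xor_ (adj-switched F y z) (adj-switched F x z)) ⟩
      (adj G x y xor s x xor s y) xor (adj G y z xor s y xor s z) xor (adj G x z xor s x xor s z)
        ≡⟨ solve 6 (λ xy yz xz sx sy sz →
                      (xy :+ (sx :+ sy)) :+ ((yz :+ (sy :+ sz)) :+ (xz :+ (sx :+ sz)))
                      := xy :+ (yz :+ xz)) refl
                   (adj G x y) (adj G y z) (adj G x z) (s x) (s y) (s z) ⟩
      triangle G x y z ∎
  }
  where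
  π = to (permutation F)
  s = switch F

record GraphEmbedding {U W : Set} (G : Graph U) (H : Graph W) : Set where
  field
    embed          : U → W
    embed-injective : ∀ x y → embed x ≡ embed y → x ≡ y
    adj-embedded   : ∀ x y → adj H (embed x) (embed y) ≡ adj G x y
open GraphEmbedding

twoGraphEmbedding : ∀ {n m} {H : Hypergraph3 n} {G : Graph (Fin n)} {Ĝ : Graph (Fin m)} →
                    Represents H G → GraphEmbedding G Ĝ → Embedding H (hyp (twoGraphOf Ĝ))
twoGraphEmbedding {H = H} {G} {Ĝ} rep ι = record
  { fun       = embed ι
  ; injective = embed-injective ι
  ; preserves = λ x y z → begin
      triangle Ĝ (embed ι x) (embed ι y) (embed ι z)
        ≡⟨ cong₂ _xor_ (adj-embedded ι x y) (cong₂ _xor_ (adj-embedded ι y z) (adj-embedded ι x z)) ⟩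
      triangle G x y z ≡⟨ sym (rep x y z) ⟩
      edge H x y z     ∎
  }

record PartialInjection (n : ℕ) : Set where
  field
    domain        : Fin n → Bool
    act           : Fin n → Fin n
    act-injective : ∀ x y → T (domain x) → T (domain y) → act x ≡ act y → x ≡ y
open PartialInjection

partialInjection : ∀ {n} {H : Hypergraph3 n} → PartialAut H → PartialInjection n
partialInjection p = record { domain = dom p ; act = φ p ; act-injective = injective p }

SwitchingOn : ∀ {n} → Graph (Fin n) → PartialInjection n → (Fin n → Bool) → Set
SwitchingOn G π s = ∀ x y → T (domain π x) → T (domain π y) →
                    adj G (act π x) (act π y) ≡ adj G x y xor s x xor s y

xor-transfer : ∀ a b c a' b' c' → a' xor b' xor c' ≡ a xor b xor c →
               b' ≡ b xor (a' xor a) xor (c' xor c)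
xor-transfer a b c a' b' c' eq = begin
  b'                                        ≡⟨ solve 3 (λ a' b' c' → b' := (a' :+ (b' :+ c')) :+ (a' :+ c')) refl a' b' c' ⟩
  (a' xor b' xor c') xor (a' xor c')        ≡⟨ cong (_xor (a' xor c')) eq ⟩
  (a xor b xor c) xor (a' xor c')           ≡⟨ solve 5 (λ a b c a' c' → (a :+ (b :+ c)) :+ (a' :+ c') := b :+ ((a' :+ a) :+ (c' :+ c))) refl a b c a' c' ⟩
  b xor (a' xor a) xor (c' xor c)           ∎

-- A partial automorphism of a two-graph is a partial switching-isomorphism
-- of any representing graph: switch at x iff the edge to a fixed base point
-- x₀ of the domain changes under the map.
partialAut-switching : ∀ {n} {H : Hypergraph3 n} {G : Graph (Fin n)} → Represents H G →
                       (p : PartialAut H) → Σ (Fin n → Bool) (SwitchingOn G (partialInjection p))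
partialAut-switching {H = H} {G} rep p with any? (λ x → T? (dom p x))
... | no empty = (λ _ → false) , λ x _ dx _ → ⊥-elim (empty (x , dx))
... | yes (x₀ , d₀) = s , switched
  where
  e = adj G
  s : Fin _ → Bool
  s x = e (φ p x₀) (φ p x) xor e x₀ x

  switched : SwitchingOn G (partialInjection p) s
  switched x y dx dy =
    xor-transfer (e x₀ x) (e x y) (e x₀ y) (e (φ p x₀) (φ p x)) (e (φ p x) (φ p y)) (e (φ p x₀) (φ p y))
      (begin
        triangle G (φ p x₀) (φ p x) (φ p y) ≡⟨ sym (rep (φ p x₀) (φ p x) (φ p y)) ⟩
        edge H (φ p x₀) (φ p x) (φ p y)     ≡⟨ preserves p x₀ x y d₀ dx dy ⟩
        edge H x₀ x y                       ≡⟨ rep x₀ x y ⟩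
        triangle G x₀ x y                   ∎)

-- Every partial injection π of Fin n extends to a permutation σ of two
-- copies Fin n ⊎ Fin n: the domain of π is mapped by π within the first
-- copy, the rest of the first copy is sent to the second copy, and the
-- second copy is sent back so as to make σ bijective.
module TwoCopyExtension {n : ℕ} (π : PartialInjection n) where
  private
    D = domain π
    f = act π

    preimage? : ∀ y → Dec (∃ λ x → T (D x) × f x ≡ y)
    preimage? y = any? (λ x → T? (D x) ×-dec (f x ≟ y))

    forward : Fin n ⊎ Fin n → Fin n ⊎ Fin n
    forward (inj₁ x) = if D x then inj₁ (f x) else inj₂ x
    forward (inj₂ y) with preimage? y
    ... | yes (x , _) = inj₂ x
    ... | no _        = inj₁ y

    backward : Fin n ⊎ Fin n → Fin n ⊎ Fin n
    backward (inj₁ y) with preimage? y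
    ... | yes (x , _) = inj₁ x
    ... | no _        = inj₂ y
    backward (inj₂ x) = if D x then inj₂ (f x) else inj₁ x

    unique-preimage : ∀ x → D x ≡ true → (q : ∃ λ x' → T (D x') × f x' ≡ f x) → proj₁ q ≡ x
    unique-preimage x dx (x' , dx' , eq) = act-injective π x' x dx' (≡true⇒T dx) eq

    has-preimage : ∀ x → D x ≡ true → ¬ ¬ (∃ λ x' → T (D x') × f x' ≡ f x)
    has-preimage x dx none = none (x , ≡true⇒T dx , refl)

    backward-forward : ∀ ℓ → backward (forward ℓ) ≡ ℓ
    backward-forward (inj₁ x) with D x in dx
    ... | false rewrite dx = refl
    ... | true with preimage? (f x)
    ...   | yes q    = cong inj₁ (unique-preimage x dx q)
    ...   | no none  = contradiction none (has-preimage x dx)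
    -- On y in the second copy, forward and backward both decide preimage? y,
    -- hence the repeated case split.
    backward-forward (inj₂ y) with preimage? y
    ... | yes (x , d , refl) rewrite T⇒≡true d = refl
    ... | no none with preimage? y
    ...   | yes q = contradiction q none
    ...   | no _  = refl

    forward-backward : ∀ ℓ → forward (backward ℓ) ≡ ℓ
    forward-backward (inj₂ x) with D x in dx
    ... | false rewrite dx = refl
    ... | true with preimage? (f x)
    ...   | yes q    = cong inj₂ (unique-preimage x dx q)
    ...   | no none  = contradiction none (has-preimage x dx)
    forward-backward (inj₁ y) with preimage? y
    ... | yes (x , d , refl) rewrite T⇒≡true d = refl
    ... | no none with preimage? y
    ...   | yes q = contradiction q none
    ...   | no _  = refl

  σ : (Fin n ⊎ Fin n) ↔ (Fin n ⊎ Fin n)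
  σ = mk↔ₛ′ forward backward forward-backward backward-forward

  σ-extends : ∀ x → T (D x) → to σ (inj₁ x) ≡ inj₁ (f x)
  σ-extends x dx rewrite T⇒≡true dx = refl

boolVectors : ∀ k → Fin (2 ^ k) ↔ Vec Bool k
boolVectors zero    = mk↔ₛ′ (λ _ → []) (λ _ → zero) (λ { [] → refl }) (λ { zero → refl })
boolVectors (suc k) = ↔-trans *↔× (↔-trans (2↔Bool ×-↔ boolVectors k) cons)
  where
  cons : (Bool × Vec Bool k) ↔ Vec Bool (suc k)
  cons = mk↔ₛ′ (λ { (b , v) → b ∷ v }) (λ { (b ∷ v) → b , v })
               (λ { (b ∷ v) → refl }) (λ { (b , v) → refl })

-- Boolean
-- functions on L are stored as vectors, so that they have extensional
-- equality; vertices are pairs (ℓ , f), and distinct positions ℓ, ℓ' are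
-- adjacent iff f ℓ' xor f' ℓ.
module ValuationGraph {L : Set} (_≟L_ : DecidableEquality L) {k : ℕ} (enum : Fin k ↔ L) where

  Valuation : Set
  Valuation = Vec Bool k

  _⟨_⟩ : Valuation → L → Bool
  f ⟨ ℓ ⟩ = lookup f (from enum ℓ)

  tab : (L → Bool) → Valuation
  tab h = tabulate (λ i → h (to enum i))

  tab-⟨⟩ : ∀ h ℓ → tab h ⟨ ℓ ⟩ ≡ h ℓ
  tab-⟨⟩ h ℓ = trans (lookup∘tabulate _ (from enum ℓ)) (cong h (strictlyInverseˡ enum ℓ))

  ⟨⟩-tab : ∀ f → tab (f ⟨_⟩) ≡ f
  ⟨⟩-tab f = trans (tabulate-cong (λ i → cong (lookup f) (strictlyInverseʳ enum i))) (tabulate∘lookup f)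

  tab-cong : ∀ {h h'} → (∀ ℓ → h ℓ ≡ h' ℓ) → tab h ≡ tab h'
  tab-cong eq = tabulate-cong (λ i → eq (to enum i))

  Vertex : Set
  Vertex = L × Valuation

  vertices : Fin (k * 2 ^ k) ↔ Vertex
  vertices = ↔-trans *↔× (enum ×-↔ boolVectors k)

  adjV : Vertex → Vertex → Bool
  adjV (ℓ , f) (ℓ' , f') with ℓ ≟L ℓ'
  ... | yes _ = false
  ... | no _  = f ⟨ ℓ' ⟩ xor f' ⟨ ℓ ⟩

  valuationGraph : Graph Vertex
  valuationGraph = record { adj = adjV ; adj-sym = adjV-sym ; adj-irrefl = adjV-irrefl }
    where
    adjV-sym : ∀ u v → adjV u v ≡ adjV v u
    adjV-sym (ℓ , f) (ℓ' , f') with ℓ ≟L ℓ' | ℓ' ≟L ℓ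
    ... | yes _  | yes _  = refl
    ... | yes eq | no ne  = contradiction (sym eq) ne
    ... | no ne  | yes eq = contradiction (sym eq) ne
    ... | no _   | no _   = xor-comm (f ⟨ ℓ' ⟩) (f' ⟨ ℓ ⟩)

    adjV-irrefl : ∀ v → adjV v v ≡ false
    adjV-irrefl (ℓ , f) with ℓ ≟L ℓ
    ... | yes _ = refl
    ... | no ne = contradiction refl ne

  point : (L → L → Bool) → L → Vertex
  point c ℓ = ℓ , tab (c ℓ)

  adj-point : ∀ c {ℓ ℓ'} → ℓ ≢ ℓ' → adjV (point c ℓ) (point c ℓ') ≡ c ℓ ℓ' xor c ℓ' ℓ
  adj-point c {ℓ} {ℓ'} ne with ℓ ≟L ℓ'
  ... | yes eq = contradiction eq ne
  ... | no _   = cong₂ _xor_ (tab-⟨⟩ (c ℓ) ℓ') (tab-⟨⟩ (c ℓ') ℓ)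

  module Move (σ : L ↔ L) (g : L → L → Bool) where
    private
      σ→ = to σ
      σ← = from σ

      σ→-injective : ∀ {ℓ ℓ'} → σ→ ℓ ≡ σ→ ℓ' → ℓ ≡ ℓ'
      σ→-injective {ℓ} {ℓ'} eq = trans (sym (strictlyInverseʳ σ ℓ)) (trans (cong σ← eq) (strictlyInverseʳ σ ℓ'))

    move : Vertex → Vertex
    move (ℓ , f) = σ→ ℓ , tab (λ z → f ⟨ σ← z ⟩ xor g ℓ (σ← z))

    unmove : Vertex → Vertex
    unmove (ℓ , f) = σ← ℓ , tab (λ y → f ⟨ σ→ y ⟩ xor g (σ← ℓ) y)

    moved-at : ∀ ℓ f y → proj₂ (move (ℓ , f)) ⟨ σ→ y ⟩ ≡ f ⟨ y ⟩ xor g ℓ y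
    moved-at ℓ f y = trans (tab-⟨⟩ (λ z → f ⟨ σ← z ⟩ xor g ℓ (σ← z)) (σ→ y))
                           (cong (λ y₀ → f ⟨ y₀ ⟩ xor g ℓ y₀) (strictlyInverseʳ σ y))

    unmove-move : ∀ v → unmove (move v) ≡ v
    unmove-move (ℓ , f) = cong₂ _,_ (strictlyInverseʳ σ ℓ) (trans (tab-cong pointwise) (⟨⟩-tab f))
      where
      pointwise : ∀ y → proj₂ (move (ℓ , f)) ⟨ σ→ y ⟩ xor g (σ← (σ→ ℓ)) y ≡ f ⟨ y ⟩
      pointwise y = begin
        proj₂ (move (ℓ , f)) ⟨ σ→ y ⟩ xor g (σ← (σ→ ℓ)) y  ≡⟨ cong₂ _xor_ (moved-at ℓ f y) (cong (λ ℓ₀ → g ℓ₀ y) (strictlyInverseʳ σ ℓ)) ⟩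
        (f ⟨ y ⟩ xor g ℓ y) xor g ℓ y                      ≡⟨ cancel (f ⟨ y ⟩) (g ℓ y) ⟩
        f ⟨ y ⟩                                            ∎

    move-unmove : ∀ v → move (unmove v) ≡ v
    move-unmove (ℓ , f) = cong₂ _,_ (strictlyInverseˡ σ ℓ) (trans (tab-cong pointwise) (⟨⟩-tab f))
      where
      unmoved = λ y → f ⟨ σ→ y ⟩ xor g (σ← ℓ) y
      pointwise : ∀ z → tab unmoved ⟨ σ← z ⟩ xor g (σ← ℓ) (σ← z) ≡ f ⟨ z ⟩
      pointwise z = begin
        tab unmoved ⟨ σ← z ⟩ xor g (σ← ℓ) (σ← z)                   ≡⟨ cong (_xor g (σ← ℓ) (σ← z)) (tab-⟨⟩ unmoved (σ← z)) ⟩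
        (f ⟨ σ→ (σ← z) ⟩ xor g (σ← ℓ) (σ← z)) xor g (σ← ℓ) (σ← z)  ≡⟨ cancel _ (g (σ← ℓ) (σ← z)) ⟩
        f ⟨ σ→ (σ← z) ⟩                                            ≡⟨ cong (f ⟨_⟩) (strictlyInverseˡ σ z) ⟩
        f ⟨ z ⟩                                                    ∎

    module _ (r : L → Bool) (antisymmetric : ∀ ℓ ℓ' → ℓ ≢ ℓ' → g ℓ ℓ' xor g ℓ' ℓ ≡ r ℓ xor r ℓ') where
      move-adj : ∀ u v → adjV (move u) (move v) ≡ adjV u v xor r (proj₁ u) xor r (proj₁ v)
      move-adj (ℓ , f) (ℓ' , f') with σ→ ℓ ≟L σ→ ℓ' | ℓ ≟L ℓ'
      ... | yes _  | yes refl = sym (xor-same (r ℓ))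
      ... | yes eq | no ne    = contradiction (σ→-injective eq) ne
      ... | no ne  | yes refl = contradiction refl ne
      ... | no _   | no ne    = begin
        proj₂ (move (ℓ , f)) ⟨ σ→ ℓ' ⟩ xor proj₂ (move (ℓ' , f')) ⟨ σ→ ℓ ⟩
          ≡⟨ cong₂ _xor_ (moved-at ℓ f ℓ') (moved-at ℓ' f' ℓ) ⟩
        (f ⟨ ℓ' ⟩ xor g ℓ ℓ') xor (f' ⟨ ℓ ⟩ xor g ℓ' ℓ)
          ≡⟨ solve 4 (λ a b c d → (a :+ b) :+ (c :+ d) := (a :+ c) :+ (b :+ d)) refl (f ⟨ ℓ' ⟩) (g ℓ ℓ') (f' ⟨ ℓ ⟩) (g ℓ' ℓ) ⟩
        (f ⟨ ℓ' ⟩ xor f' ⟨ ℓ ⟩) xor (g ℓ ℓ' xor g ℓ' ℓ)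
          ≡⟨ cong ((f ⟨ ℓ' ⟩ xor f' ⟨ ℓ ⟩) xor_) (antisymmetric ℓ ℓ' ne) ⟩
        (f ⟨ ℓ' ⟩ xor f' ⟨ ℓ ⟩) xor r ℓ xor r ℓ' ∎

      moveSwitching : Switching valuationGraph
      moveSwitching = record
        { permutation  = mk↔ₛ′ move unmove move-unmove unmove-move
        ; switch       = λ v → r (proj₁ v)
        ; adj-switched = move-adj
        }

    move-point : ∀ c ℓ → (∀ w → g ℓ w ≡ c (σ→ ℓ) (σ→ w) xor c ℓ w) → move (point c ℓ) ≡ point c (σ→ ℓ)
    move-point c ℓ g-row = cong (σ→ ℓ ,_) (tab-cong pointwise)
      where
      pointwise : ∀ z → tab (c ℓ) ⟨ σ← z ⟩ xor g ℓ (σ← z) ≡ c (σ→ ℓ) z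
      pointwise z = begin
        tab (c ℓ) ⟨ σ← z ⟩ xor g ℓ (σ← z)                      ≡⟨ cong₂ _xor_ (tab-⟨⟩ (c ℓ) (σ← z)) (g-row (σ← z)) ⟩
        c ℓ (σ← z) xor c (σ→ ℓ) (σ→ (σ← z)) xor c ℓ (σ← z)     ≡⟨ solve 2 (λ a b → a :+ (b :+ a) := b) refl (c ℓ (σ← z)) _ ⟩
        c (σ→ ℓ) (σ→ (σ← z))                                   ≡⟨ cong (c (σ→ ℓ)) (strictlyInverseˡ σ z) ⟩
        c (σ→ ℓ) z                                             ∎

module Correction {L : Set} (inD : L → Bool) (prescribed : L → L → Bool) (ρ : L → Bool) where

  r : L → Bool
  r ℓ = inD ℓ ∧ ρ ℓ

  g : L → L → Bool
  g ℓ ℓ' = if inD ℓ then prescribed ℓ ℓ' else if inD ℓ' then prescribed ℓ' ℓ xor ρ ℓ' else false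

  g-on-domain : ∀ {ℓ} → T (inD ℓ) → ∀ w → g ℓ w ≡ prescribed ℓ w
  g-on-domain d w rewrite T⇒≡true d = refl

  g-antisymmetric :
    (∀ ℓ ℓ' → ℓ ≢ ℓ' → T (inD ℓ) → T (inD ℓ') → prescribed ℓ ℓ' xor prescribed ℓ' ℓ ≡ ρ ℓ xor ρ ℓ') →
    ∀ ℓ ℓ' → ℓ ≢ ℓ' → g ℓ ℓ' xor g ℓ' ℓ ≡ r ℓ xor r ℓ'
  g-antisymmetric on-domain ℓ ℓ' ne with inD ℓ in d | inD ℓ' in d'
  ... | true  | true  = on-domain ℓ ℓ' ne (≡true⇒T d) (≡true⇒T d')
  -- Across the boundary of D the correction is forced, and off D it is zero.
  ... | true  | false = solve 2 (λ a b → a :+ (a :+ b) := b :+ con false) refl (prescribed ℓ ℓ') (ρ ℓ)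
  ... | false | true  = solve 2 (λ a b → (a :+ b) :+ a := b) refl (prescribed ℓ' ℓ) (ρ ℓ')
  ... | false | false = refl

orientation : ∀ {n} (G : Graph (Fin n)) →
              Σ (Fin n → Fin n → Bool) λ o → ∀ x y → x ≢ y → o x y xor o y x ≡ adj G x y
orientation G = o , oriented
  where
  o = λ x y → does (y <? x) ∧ adj G x y
  oriented : ∀ x y → x ≢ y → o x y xor o y x ≡ adj G x y
  oriented x y x≢y with <-cmp x y
  ... | tri< x<y _ y≮x rewrite dec-false (y <? x) y≮x | dec-true (x <? y) x<y = adj-sym G y x
  ... | tri≈ _ x≡y _   = contradiction x≡y x≢y
  ... | tri> x≮y _ y<x rewrite dec-true (y <? x) y<x | dec-false (x <? y) x≮y = xor-identityʳ (adj G x y)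

transport : ∀ {m} {V : Set} → Fin m ↔ V → Graph V → Graph (Fin m)
transport β G = record
  { adj        = λ i j → adj G (to β i) (to β j)
  ; adj-sym    = λ i j → adj-sym G (to β i) (to β j)
  ; adj-irrefl = λ i → adj-irrefl G (to β i)
  }

module _ {m : ℕ} {V : Set} (β : Fin m ↔ V) {G : Graph V} where

  transport-embedding : ∀ {U} {H : Graph U} → GraphEmbedding H G → GraphEmbedding H (transport β G)
  transport-embedding ι = record
    { embed           = λ x → from β (embed ι x)
    ; embed-injective = λ x y eq → embed-injective ι x y
        (trans (sym (strictlyInverseˡ β _)) (trans (cong (to β) eq) (strictlyInverseˡ β _)))
    ; adj-embedded    = λ x y → trans (cong₂ (adj G) (strictlyInverseˡ β _) (strictlyInverseˡ β _)) (adj-embedded ι x y)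
    }

  transport-switching : Switching G → Switching (transport β G)
  transport-switching F = record
    { permutation  = ↔-trans β (↔-trans (permutation F) (↔-sym β))
    ; switch       = λ i → switch F (to β i)
    ; adj-switched = λ i j → trans (cong₂ (adj G) (strictlyInverseˡ β _) (strictlyInverseˡ β _))
                                   (adj-switched F (to β i) (to β j))
    }

ExtendsPartial : ∀ {n} {W : Set} {G : Graph (Fin n)} {H : Graph W} →
                 GraphEmbedding G H → PartialInjection n → Switching H → Set
ExtendsPartial ι π F = ∀ x → T (domain π x) → to (permutation F) (embed ι x) ≡ embed ι (act π x)

transport-extends : ∀ {n m} {V : Set} (β : Fin m ↔ V) {G : Graph (Fin n)} {H : Graph V}
                    {ι : GraphEmbedding G H} {π : PartialInjection n} {F : Switching H} →
                    ExtendsPartial ι π F →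
                    ExtendsPartial (transport-embedding β ι) π (transport-switching β F)
transport-extends β {ι = ι} {F = F} extends x d =
  cong (from β) (trans (cong (to (permutation F)) (strictlyInverseˡ β (embed ι x))) (extends x d))

module SwitchingEPPA {n : ℕ} (G : Graph (Fin n)) where

  L : Set
  L = Fin n ⊎ Fin n

  open ValuationGraph (≡-dec _≟_ _≟_) (+↔⊎ {n} {n}) public

  õ : L → L → Bool
  õ (inj₁ x) (inj₁ y) = proj₁ (orientation G) x y
  õ _        _        = false

  ι : GraphEmbedding G valuationGraph
  ι = record
    { embed           = λ x → point õ (inj₁ x)
    ; embed-injective = λ x y eq → inj₁-injective (cong proj₁ eq)
    ; adj-embedded    = λ x y → adj-embedded′ x y (x ≟ y)
    }
    where
    -- The case split on x ≟ y is passed as an argument, so that it is not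
    -- abstracted inside adjV, which performs its own test.
    adj-embedded′ : ∀ x y → Dec (x ≡ y) → adjV (point õ (inj₁ x)) (point õ (inj₁ y)) ≡ adj G x y
    adj-embedded′ x _ (yes refl) = trans (adj-irrefl valuationGraph (point õ (inj₁ x))) (sym (adj-irrefl G x))
    adj-embedded′ x y (no x≢y)   = trans (adj-point õ (λ eq → x≢y (inj₁-injective eq))) (proj₂ (orientation G) x y x≢y)

  module Extension (π : PartialInjection n) (s : Fin n → Bool) (switched : SwitchingOn G π s) where
    open TwoCopyExtension π using (σ; σ-extends)

    inD : L → Bool
    inD (inj₁ x) = domain π x
    inD (inj₂ _) = false

    ρ : L → Bool
    ρ (inj₁ x) = s x
    ρ (inj₂ _) = false

    -- The correction forced on rows of the embedded copy of G.
    prescribed : L → L → Bool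
    prescribed ℓ w = õ (to σ ℓ) (to σ w) xor õ ℓ w

    -- On the domain, the prescription is antisymmetric up to s: this is
    -- where π being a partial switching-isomorphism is used.
    prescribed-antisymmetric : ∀ ℓ ℓ' → ℓ ≢ ℓ' → T (inD ℓ) → T (inD ℓ') →
                               prescribed ℓ ℓ' xor prescribed ℓ' ℓ ≡ ρ ℓ xor ρ ℓ'
    prescribed-antisymmetric (inj₁ x) (inj₁ y) ne dx dy
      rewrite σ-extends x dx | σ-extends y dy = begin
        (o fx fy xor o x y) xor (o fy fx xor o y x)
          ≡⟨ solve 4 (λ a b c d → (a :+ b) :+ (c :+ d) := (a :+ c) :+ (b :+ d)) refl (o fx fy) (o x y) (o fy fx) (o y x) ⟩
        (o fx fy xor o fy fx) xor (o x y xor o y x)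
          ≡⟨ cong₂ _xor_ (oriented fx fy fx≢fy) (oriented x y x≢y) ⟩
        adj G fx fy xor adj G x y
          ≡⟨ cong (_xor adj G x y) (switched x y dx dy) ⟩
        (adj G x y xor s x xor s y) xor adj G x y
          ≡⟨ solve 3 (λ a b c → (a :+ (b :+ c)) :+ a := b :+ c) refl (adj G x y) (s x) (s y) ⟩
        s x xor s y ∎
      where
      o = proj₁ (orientation G)
      oriented = proj₂ (orientation G)
      fx = act π x
      fy = act π y
      x≢y : x ≢ y
      x≢y eq = ne (cong inj₁ eq)
      fx≢fy : fx ≢ fy
      fx≢fy eq = x≢y (act-injective π x y dx dy eq)

    open Correction inD prescribed ρ
    open Move σ g

    F : Switching valuationGraph
    F = moveSwitching r (g-antisymmetric prescribed-antisymmetric)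

    extends : ExtendsPartial ι π F
    extends x dx = trans (move-point õ (inj₁ x) (g-on-domain dx)) (cong (point õ) (σ-extends x dx))

graphs-have-switching-EPPA :
  ∀ {n} (G : Graph (Fin n)) →
  Σ ℕ λ M → Σ (Graph (Fin M)) λ Ĝ → Σ (GraphEmbedding G Ĝ) λ ι →
    ∀ (π : PartialInjection n) (s : Fin n → Bool) → SwitchingOn G π s →
    Σ (Switching Ĝ) (ExtendsPartial ι π)
graphs-have-switching-EPPA {n} G =
  (n + n) * 2 ^ (n + n) , transport vertices valuationGraph , transport-embedding vertices ι ,
  λ π s switched → let open Extension π s switched in
    transport-switching vertices F , transport-extends vertices {ι = ι} {π = π} {F = F} extends
  where open SwitchingEPPA G

theorem1p1 : TwoGraphsHaveEPPA
theorem1p1 n A = case represent A of λ where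
  (G , represents) → case graphs-have-switching-EPPA G of λ where
    (M , Ĝ , ι , extend) → M , twoGraphOf Ĝ , twoGraphEmbedding represents ι , λ p →
      case partialAut-switching {G = G} represents p of λ where
        (s , switched) → case extend (partialInjection p) s switched of λ where
          (F , extends) → switching⇒automorphism F , extends
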